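{- Let $G$ be a map on an orientable surface. Every EDGE angle labeling of $G$ is VERTEX and FACE.
   Context: A map is a graph embedded on an orientable surface with all faces open disks (no contractible cycles of length 1 or 2). An angle labeling is a map $\ell$ from the angles (face corners) of $G$ to $\{0,1,2\}=\mathbb{Z}_3$. A vertex or face $v$ is of type $k\ge1$ if the labels of the angles around $v$ form, in counterclockwise (cyclic) order, $3k$ nonempty intervals with all labels of the $j$-th interval equal to $j \bmod 3$; it is of type 0 if all its angles have the same label. An edge $e$ is of type 0 if its four incident angles all have the same label, and of type 1 or 2 if their labels in clockwise order are $i-1,i,i,i+1$ for some $i$ (type 1 if the two angles labeled $i$ are at the same extremity of $e$, type 2 if on the same side). The labeling is EDGE (resp. VERTEX, FACE) if every edge (resp. vertex, face) has some type. -}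

module Defs where

open import Data.Nat using (ℕ; zero; suc; _+_; _≤_; _<_)
open import Data.Fin using (Fin; toℕ) renaming (_≤_ to _≤ᶠ_)
import Data.Fin as F
open import Data.Fin.Permutation using (Permutation′; _⟨$⟩ʳ_; _⟨$⟩ˡ_)
open import Data.Product using (Σ; ∃; _×_; _,_)
open import Data.Sum using (_⊎_)
open import Relation.Binary.PropositionalEquality using (_≡_; _≢_)
open import Relation.Binary.Construct.Closure.ReflexiveTransitive using (Star)

-- Combinatorial maps (rotation systems) = maps on orientable surfaces.
-- Darts (half-edges) are Fin n.  α pairs the two darts of an edge
-- (fixed-point-free involution), σ is the counterclockwise rotation of
-- darts around their vertex.  Vertices = σ-orbits, edges = α-orbits,
-- faces = orbits of the face permutation φ = σ⁻¹ ∘ α (see below).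

record Map : Set where
  field
    n          : ℕ
    α          : Permutation′ n
    σ          : Permutation′ n
    α-invol    : ∀ d → α ⟨$⟩ʳ (α ⟨$⟩ʳ d) ≡ d
    α-nofix    : ∀ d → α ⟨$⟩ʳ d ≢ d
    connected  : ∀ d e → Star (λ x y → (y ≡ σ ⟨$⟩ʳ x) ⊎ (y ≡ α ⟨$⟩ʳ x)) d e

  Dart : Set
  Dart = Fin n

  σ→ : Dart → Dart
  σ→ d = σ ⟨$⟩ʳ d

  σ← : Dart → Dart
  σ← d = σ ⟨$⟩ˡ d

  α→ : Dart → Dart
  α→ d = α ⟨$⟩ʳ d

  -- Angles (corners) are indexed by darts: angle d is the corner at the
  -- vertex of d lying between d and σ d (counterclockwise from d).
  -- Walking counterclockwise around the face containing angle d, the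
  -- next angle is angle (σ⁻¹ (α d)).
  φ→ : Dart → Dart
  φ→ d = σ← (α→ d)

open Map public

mod3 : ℕ → Fin 3
mod3 0 = F.zero
mod3 1 = F.suc F.zero
mod3 2 = F.suc (F.suc F.zero)
mod3 (suc (suc (suc k))) = mod3 k

inc3 : Fin 3 → Fin 3
inc3 i = mod3 (suc (toℕ i))

dec3 : Fin 3 → Fin 3
dec3 i = mod3 (2 + toℕ i)

Labeling : Map → Set
Labeling G = Dart G → Fin 3

iter : ∀ {A : Set} → (A → A) → ℕ → A → A
iter f zero    x = x
iter f (suc j) x = f (iter f j x)

IsOrbitLength : ∀ {A : Set} → (A → A) → A → ℕ → Set
IsOrbitLength f x m =
  (1 ≤ m) × (iter f m x ≡ x) × (∀ j → 1 ≤ j → j < m → iter f j x ≢ x)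

IsType0 : ∀ {A : Set} → (A → Fin 3) → (A → A) → A → ℕ → Set
IsType0 ℓ f x m = ∀ j → j < m → ℓ (iter f j x) ≡ ℓ x

-- Type k (k ≥ 1): in cyclic order (starting at a suitable position s)
-- the labels form 3k nonempty intervals, the j-th interval
-- (j = 1,…,3k) having all labels equal to j mod 3.  The interval
-- containing position p is given by a monotone surjection
-- I : Fin m → Fin (3k) (value t meaning interval number t+1).
IsTypeK : ∀ {A : Set} → (A → Fin 3) → (A → A) → A → ℕ → ℕ → Set
IsTypeK ℓ f x m k =
  Σ ℕ λ s → Σ (Fin m → Fin (3 Data.Nat.* k)) λ I →
      (∀ p q → p ≤ᶠ q → I p ≤ᶠ I q)
    × (∀ t → ∃ λ p → I p ≡ t)
    × (∀ p → ℓ (iter f (s + toℕ p) x) ≡ mod3 (suc (toℕ (I p))))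

HasType : ∀ {A : Set} → (A → Fin 3) → (A → A) → A → ℕ → Set
HasType ℓ f x m = IsType0 ℓ f x m ⊎ (Σ ℕ λ k → (1 ≤ k) × IsTypeK ℓ f x m k)

IsVERTEX : (G : Map) → Labeling G → Set
IsVERTEX G ℓ = ∀ d m → IsOrbitLength (σ→ G) d m → HasType ℓ (σ→ G) d m

IsFACE : (G : Map) → Labeling G → Set
IsFACE G ℓ = ∀ d m → IsOrbitLength (φ→ G) d m → HasType ℓ (φ→ G) d m

-- Edge e = {d, α d}, d going from u to v.  Its four incident angles, in
-- clockwise order around e:
--   A = angle d           (at u, left side of d)
--   B = angle σ⁻¹(α d)    (at v, left side of d)
--   C = angle α d         (at v, right side of d)
--   D = angle σ⁻¹ d       (at u, right side of d)
-- A,D are at extremity u and B,C at extremity v;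
-- A,B are on one side and C,D on the other.
module _ (G : Map) (ℓ : Labeling G) (d : Dart G) where
  private
    A = ℓ d
    B = ℓ (σ← G (α→ G d))
    C = ℓ (α→ G d)
    D = ℓ (σ← G d)

  EdgeType0 : Set
  EdgeType0 = (A ≡ B) × (B ≡ C) × (C ≡ D)

  -- clockwise i-1,i,i,i+1 with the two i's at the same extremity
  EdgeType1 : Set
  EdgeType1 = Σ (Fin 3) λ i →
      ((B ≡ i) × (C ≡ i) × (D ≡ inc3 i) × (A ≡ dec3 i))
    ⊎ ((D ≡ i) × (A ≡ i) × (B ≡ inc3 i) × (C ≡ dec3 i))

  -- clockwise i-1,i,i,i+1 with the two i's on the same side
  EdgeType2 : Set
  EdgeType2 = Σ (Fin 3) λ i →
      ((A ≡ i) × (B ≡ i) × (C ≡ inc3 i) × (D ≡ dec3 i))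
    ⊎ ((C ≡ i) × (D ≡ i) × (A ≡ inc3 i) × (B ≡ dec3 i))

  EdgeHasType : Set
  EdgeHasType = EdgeType0 ⊎ EdgeType1 ⊎ EdgeType2

IsEDGE : (G : Map) → Labeling G → Set
IsEDGE G ℓ = ∀ d → EdgeHasType G ℓ d

module Submission where

-- Call a step from label u to label w a climb if w = u or w = u + 1 in
-- ℤ₃.  Inspecting the edge types shows that passing counterclockwise
-- around a vertex or a face across any edge is a climb, so it suffices
-- to show that every cyclic label sequence made of climbs has a type.
-- There the label at s + p is the label at s raised by the number of
-- rises in the window [s, s + p).  Once around the cycle the labels
-- return, so the number N of rises is a multiple of 3.  If N = 0 the
-- cycle has type 0; if N = 3k with k ≥ 1, counting rises from a step
-- entering label 1 is a monotone surjection onto {0, …, 3k-1} giving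
-- the 3k intervals of type k.  The file proves, in order: facts about
-- ℤ₃, counting 0/1 sequences and the interval map they induce, that
-- climbing cycles have a type, that edges yield climbs, the theorem.

open import Defs

open import Data.Nat using (ℕ; zero; suc; _+_; _*_; _≤_; _<_; z≤n; s≤s; s≤s⁻¹; s<s⁻¹)
open import Data.Nat.Properties
  using (+-identityʳ; +-suc; +-assoc; +-comm; *-comm; +-cancelʳ-≡; +-cancelʳ-≤; +-monoˡ-≤;
         ≤-refl; ≤-trans; ≤-antisym; <⇒≤; ≮⇒≥; m≤n+m; m≤m*n; n≤0⇒n≡0; m<n⇒m<1+n;
         m≤n⇒m<n∨m≡n; _<?_)
open import Data.Nat.Divisibility using (_∣_; divides)
open import Data.Fin using (Fin; toℕ; fromℕ<) renaming (zero to fz; suc to fs; _≤_ to _≤ᶠ_)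
open import Data.Fin.Properties using (toℕ-fromℕ<; toℕ-injective; toℕ<n)
open import Data.Fin.Permutation using (inverseˡ)
open import Data.Product using (∃; _×_; _,_; proj₁; proj₂)
open import Data.Sum using (_⊎_; inj₁; inj₂)
open import Data.Empty using (⊥-elim)
open import Function using (_∘_)
open import Relation.Nullary using (yes; no)
open import Relation.Binary.PropositionalEquality
  using (_≡_; _≢_; refl; sym; trans; cong; cong₂; subst; subst₂; module ≡-Reasoning)
open ≡-Reasoning

mod3-suc : ∀ n → mod3 (suc n) ≡ inc3 (mod3 n)
mod3-suc 0 = refl
mod3-suc 1 = refl
mod3-suc 2 = refl
mod3-suc (suc (suc (suc n))) = mod3-suc n

mod3-toℕ : ∀ (i : Fin 3) → mod3 (toℕ i) ≡ i
mod3-toℕ fz = refl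
mod3-toℕ (fs fz) = refl
mod3-toℕ (fs (fs fz)) = refl

inc3-dec3 : ∀ i → inc3 (dec3 i) ≡ i
inc3-dec3 fz = refl
inc3-dec3 (fs fz) = refl
inc3-dec3 (fs (fs fz)) = refl

dec3≡inc3² : ∀ i → dec3 i ≡ inc3 (inc3 i)
dec3≡inc3² fz = refl
dec3≡inc3² (fs fz) = refl
dec3≡inc3² (fs (fs fz)) = refl

inc3-no-fixpoint : ∀ i → inc3 i ≢ i
inc3-no-fixpoint fz ()
inc3-no-fixpoint (fs fz) ()
inc3-no-fixpoint (fs (fs fz)) ()

inc3²-no-fixpoint : ∀ i → inc3 (inc3 i) ≢ i
inc3²-no-fixpoint fz ()
inc3²-no-fixpoint (fs fz) ()
inc3²-no-fixpoint (fs (fs fz)) ()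

mod3-period : ∀ N t → mod3 (N + t) ≡ mod3 t → 3 ∣ N
mod3-period 0 t _ = divides 0 refl
mod3-period 1 t eq = ⊥-elim (inc3-no-fixpoint (mod3 t) (trans (sym (mod3-suc t)) eq))
mod3-period 2 t eq = ⊥-elim (inc3²-no-fixpoint (mod3 t)
  (trans (sym (trans (mod3-suc (suc t)) (cong inc3 (mod3-suc t)))) eq))
mod3-period (suc (suc (suc N))) t eq with mod3-period N t eq
... | divides q N≡ = divides (suc q) (cong (3 +_) N≡)

offset-to-one : ∀ (i : Fin 3) → ∃ λ v → v < 3 × mod3 (suc v + toℕ i) ≡ fs fz
offset-to-one fz = 0 , s≤s z≤n , refl
offset-to-one (fs fz) = 2 , ≤-refl , refl
offset-to-one (fs (fs fz)) = 1 , s≤s (s≤s z≤n) , refl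

Climbs : Fin 3 → Fin 3 → Set
Climbs u w = w ≡ u ⊎ w ≡ inc3 u

ascent : ∀ {u w} → Climbs u w → ℕ
ascent (inj₁ _) = 0
ascent (inj₂ _) = 1

ascent≤1 : ∀ {u w} (step : Climbs u w) → ascent step ≤ 1
ascent≤1 (inj₁ _) = z≤n
ascent≤1 (inj₂ _) = s≤s z≤n

climb-lift : ∀ {u w} (step : Climbs u w) {n} → u ≡ mod3 n → w ≡ mod3 (ascent step + n)
climb-lift (inj₁ w≡u) u≡ = trans w≡u u≡
climb-lift (inj₂ w≡u+1) {n} u≡ = trans w≡u+1 (trans (cong inc3 u≡) (sym (mod3-suc n)))

cnt : (ℕ → ℕ) → ℕ → ℕ
cnt c zero = 0
cnt c (suc p) = c p + cnt c p

cnt-mono : (c : ℕ → ℕ) {p q : ℕ} → p ≤ q → cnt c p ≤ cnt c q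
cnt-mono c {q = zero} z≤n = ≤-refl
cnt-mono c {p} {suc q} p≤1+q with m≤n⇒m<n∨m≡n p≤1+q
... | inj₁ p<1+q = ≤-trans (cnt-mono c (s≤s⁻¹ p<1+q)) (m≤n+m (cnt c q) (c q))
... | inj₂ refl = ≤-refl

-- sums of pointwise equal sequences agree (no function extensionality)
cnt-cong : {c c′ : ℕ → ℕ} → (∀ q → c q ≡ c′ q) → ∀ p → cnt c p ≡ cnt c′ p
cnt-cong eq zero = refl
cnt-cong eq (suc p) = cong₂ _+_ (eq p) (cnt-cong eq p)

cnt-shift : ∀ c s p → cnt c (s + p) ≡ cnt (λ q → c (s + q)) p + cnt c s
cnt-shift c s zero = cong (cnt c) (+-identityʳ s)
cnt-shift c s (suc p) = begin
  cnt c (s + suc p)                                   ≡⟨ cong (cnt c) (+-suc s p) ⟩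
  c (s + p) + cnt c (s + p)                           ≡⟨ cong (c (s + p) +_) (cnt-shift c s p) ⟩
  c (s + p) + (cnt (λ q → c (s + q)) p + cnt c s)     ≡⟨ sym (+-assoc (c (s + p)) _ _) ⟩
  cnt (λ q → c (s + q)) (suc p) + cnt c s             ∎

cnt-window : (c : ℕ → ℕ) {m : ℕ} → (∀ q → c (m + q) ≡ c q) →
             ∀ s → cnt (λ q → c (s + q)) m ≡ cnt c m
cnt-window c {m} periodic s = +-cancelʳ-≡ (cnt c s) _ _ (begin
  cnt (λ q → c (s + q)) m + cnt c s   ≡⟨ sym (cnt-shift c s m) ⟩
  cnt c (s + m)                       ≡⟨ cong (cnt c) (+-comm s m) ⟩
  cnt c (m + s)                       ≡⟨ cnt-shift c m s ⟩
  cnt (λ q → c (m + q)) s + cnt c m   ≡⟨ cong (_+ cnt c m) (cnt-cong periodic s) ⟩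
  cnt c s + cnt c m                   ≡⟨ +-comm (cnt c s) (cnt c m) ⟩
  cnt c m + cnt c s                   ∎)

cnt-crossing : (c : ℕ → ℕ) → (∀ p → c p ≤ 1) →
               ∀ hi w → w < cnt c hi → ∃ λ s → s < hi × cnt c s ≡ w × c s ≡ 1
cnt-crossing c c≤1 zero w ()
cnt-crossing c c≤1 (suc h) w w< with w <? cnt c h
... | yes w<h with cnt-crossing c c≤1 h w w<h
...   | s , s<h , cnt≡w , rise = s , m<n⇒m<1+n s<h , cnt≡w , rise
cnt-crossing c c≤1 (suc h) w w< | no w≮h = h , ≤-refl , cnt≡w , c≡1
  where
    cnt≡w : cnt c h ≡ w
    cnt≡w = ≤-antisym (≮⇒≥ w≮h) (s≤s⁻¹ (≤-trans w< (+-monoˡ-≤ (cnt c h) (c≤1 h))))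
    c≡1 : c h ≡ 1
    c≡1 = ≤-antisym (c≤1 h)
      (+-cancelʳ-≤ (cnt c h) 1 (c h) (subst (λ z → suc z ≤ c h + cnt c h) (sym cnt≡w) w<))

module Intervals (c : ℕ → ℕ) (c≤1 : ∀ p → c p ≤ 1) {m K : ℕ}
                 (total : suc (cnt c m) ≡ K) where

  below : (p : Fin (suc m)) → cnt c (toℕ p) < K
  below p = subst (cnt c (toℕ p) <_) total (s≤s (cnt-mono c (s≤s⁻¹ (toℕ<n p))))

  interval : Fin (suc m) → Fin K
  interval p = fromℕ< (below p)

  interval-toℕ : ∀ p → toℕ (interval p) ≡ cnt c (toℕ p)
  interval-toℕ p = toℕ-fromℕ< (below p)

  interval-mono : ∀ p q → p ≤ᶠ q → interval p ≤ᶠ interval q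
  interval-mono p q p≤q =
    subst₂ _≤_ (sym (interval-toℕ p)) (sym (interval-toℕ q)) (cnt-mono c p≤q)

  reached : ∀ w → w < K → ∃ λ e → e ≤ m × cnt c e ≡ w
  reached zero _ = 0 , z≤n , refl
  reached (suc w) w<K
    with cnt-crossing c c≤1 m w (s<s⁻¹ (subst (suc w <_) (sym total) w<K))
  ... | s , s<m , cnt≡w , rise = suc s , s<m , cong₂ _+_ rise cnt≡w

  interval-surj : ∀ t → ∃ λ p → interval p ≡ t
  interval-surj t with reached (toℕ t) (toℕ<n t)
  ... | e , e≤m , cnt≡t = fromℕ< (s≤s e≤m) , toℕ-injective (begin
    toℕ (interval (fromℕ< (s≤s e≤m)))   ≡⟨ interval-toℕ (fromℕ< (s≤s e≤m)) ⟩
    cnt c (toℕ (fromℕ< (s≤s e≤m)))      ≡⟨ cong (cnt c) (toℕ-fromℕ< (s≤s e≤m)) ⟩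
    cnt c e                              ≡⟨ cnt≡t ⟩
    toℕ t                                ∎)

iter-+ : ∀ {A : Set} (f : A → A) p q x → iter f (p + q) x ≡ iter f p (iter f q x)
iter-+ f zero q x = refl
iter-+ f (suc p) q x = cong f (iter-+ f p q x)

module ClimbingCycle {A : Set} (ℓ : A → Fin 3) (f : A → A)
                     (climbs : ∀ y → Climbs (ℓ y) (ℓ (f y)))
                     (x : A) (m′ : ℕ) (cycle : iter f (suc m′) x ≡ x) where

  m : ℕ
  m = suc m′

  label : ℕ → Fin 3
  label p = ℓ (iter f p x)

  rise : ℕ → ℕ
  rise p = ascent (climbs (iter f p x))

  rise≤1 : ∀ p → rise p ≤ 1
  rise≤1 p = ascent≤1 (climbs (iter f p x))

  rise-periodic : ∀ q → rise (m + q) ≡ rise q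
  rise-periodic q = cong (λ y → ascent (climbs y)) (begin
    iter f (m + q) x          ≡⟨ cong (λ n → iter f n x) (+-comm m q) ⟩
    iter f (q + m) x          ≡⟨ iter-+ f q m x ⟩
    iter f q (iter f m x)     ≡⟨ cong (iter f q) cycle ⟩
    iter f q x                ∎)

  label-lift : ∀ s p → label (s + p) ≡ mod3 (cnt (λ q → rise (s + q)) p + toℕ (label s))
  label-lift s zero = trans (cong label (+-identityʳ s)) (sym (mod3-toℕ (label s)))
  label-lift s (suc p) = begin
    label (s + suc p)   ≡⟨ cong label (+-suc s p) ⟩
    label (suc (s + p)) ≡⟨ climb-lift (climbs (iter f (s + p) x)) (label-lift s p) ⟩
    mod3 (rise (s + p) + (cnt (λ q → rise (s + q)) p + toℕ (label s)))
                        ≡⟨ cong mod3 (sym (+-assoc (rise (s + p)) _ _)) ⟩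
    mod3 (cnt (λ q → rise (s + q)) (suc p) + toℕ (label s)) ∎

  t₀ : ℕ
  t₀ = toℕ (label 0)

  rises-multiple-of-3 : 3 ∣ cnt rise m
  rises-multiple-of-3 = mod3-period (cnt rise m) t₀
    (trans (sym (label-lift 0 m)) (trans (cong ℓ cycle) (label-lift 0 0)))

  constant-if-no-rise : cnt rise m ≡ 0 → IsType0 ℓ f x m
  constant-if-no-rise none j j<m = begin
    label j                  ≡⟨ label-lift 0 j ⟩
    mod3 (cnt rise j + t₀)   ≡⟨ cong (λ r → mod3 (r + t₀)) no-rise-yet ⟩
    mod3 t₀                  ≡⟨ sym (label-lift 0 0) ⟩
    label 0                  ∎
    where
      no-rise-yet : cnt rise j ≡ 0
      no-rise-yet = n≤0⇒n≡0 (subst (cnt rise j ≤_) none (cnt-mono rise (<⇒≤ j<m)))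

  enters-one : 3 ≤ cnt rise m → ∃ λ s → rise s ≡ 1 × label (suc s) ≡ fs fz
  enters-one 3≤N with offset-to-one (label 0)
  ... | v , v<3 , v-reaches-one with cnt-crossing rise rise≤1 m v (≤-trans v<3 3≤N)
  ...   | s , _ , rises≡v , rise≡1 = s , rise≡1 , (begin
    label (suc s)                         ≡⟨ label-lift 0 (suc s) ⟩
    mod3 ((rise s + cnt rise s) + t₀)     ≡⟨ cong (λ r → mod3 (r + t₀)) (cong₂ _+_ rise≡1 rises≡v) ⟩
    mod3 (suc v + t₀)                     ≡⟨ v-reaches-one ⟩
    fs fz                                 ∎)

  intervals-if-rises : ∀ k → cnt rise m ≡ 3 * suc k → IsTypeK ℓ f x m (suc k)
  intervals-if-rises k N≡3K with enters-one (subst (3 ≤_) (sym N≡3K) (m≤m*n 3 (suc k)))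
  ... | s₀ , rise≡1 , enters = s , interval , interval-mono , interval-surj , labels
    where
      s : ℕ
      s = suc s₀

      window : ℕ → ℕ
      window q = rise (s + q)

      -- the window ends with the rise that precedes s one period later
      last-rise : rise (s + m′) ≡ 1
      last-rise = trans (cong (rise ∘ suc) (+-comm s₀ m′)) (trans (rise-periodic s₀) rise≡1)

      total : suc (cnt window m′) ≡ 3 * suc k
      total = begin
        suc (cnt window m′)   ≡⟨ cong (_+ cnt window m′) (sym last-rise) ⟩
        cnt window m          ≡⟨ cnt-window rise rise-periodic s ⟩
        cnt rise m            ≡⟨ N≡3K ⟩
        3 * suc k             ∎

      open Intervals window (λ q → rise≤1 (s + q)) {m′} total

      labels : ∀ p → ℓ (iter f (s + toℕ p) x) ≡ mod3 (suc (toℕ (interval p)))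
      labels p = begin
        label (s + toℕ p)                          ≡⟨ label-lift s (toℕ p) ⟩
        mod3 (cnt window (toℕ p) + toℕ (label s))  ≡⟨ cong (λ i → mod3 (cnt window (toℕ p) + toℕ i)) enters ⟩
        mod3 (cnt window (toℕ p) + 1)              ≡⟨ cong mod3 (+-comm (cnt window (toℕ p)) 1) ⟩
        mod3 (suc (cnt window (toℕ p)))            ≡⟨ cong (mod3 ∘ suc) (sym (interval-toℕ p)) ⟩
        mod3 (suc (toℕ (interval p)))              ∎

  has-type : HasType ℓ f x m
  has-type with rises-multiple-of-3
  ... | divides zero none = inj₁ (constant-if-no-rise none)
  ... | divides (suc k) N≡ =
    inj₂ (suc k , s≤s z≤n , intervals-if-rises k (trans N≡ (*-comm (suc k) 3)))

climbing-orbits-have-types : ∀ {A : Set} (ℓ : A → Fin 3) (f : A → A) →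
  (∀ y → Climbs (ℓ y) (ℓ (f y))) → ∀ x m → IsOrbitLength f x m → HasType ℓ f x m
climbing-orbits-have-types ℓ f climbs x zero (() , _ , _)
climbing-orbits-have-types ℓ f climbs x (suc m′) (_ , cycle , _) =
  ClimbingCycle.has-type ℓ f climbs x m′ cycle

-- With the angles A, B, C, D of an edge in clockwise order, a typed edge
-- climbs from D to A (around the vertex of d) and from A to B (around
-- the face of angle d).
edge-climbs : (G : Map) (ℓ : Labeling G) (d : Dart G) → EdgeHasType G ℓ d →
              Climbs (ℓ (σ← G d)) (ℓ d) × Climbs (ℓ d) (ℓ (φ→ G d))
edge-climbs G ℓ d (inj₁ (a≡b , b≡c , c≡d)) =
  inj₁ (trans a≡b (trans b≡c c≡d)) , inj₁ (sym a≡b)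
edge-climbs G ℓ d (inj₂ (inj₁ (i , inj₁ (b≡i , _ , d≡i+1 , a≡i-1)))) =
  inj₂ (trans a≡i-1 (trans (dec3≡inc3² i) (cong inc3 (sym d≡i+1)))) ,
  inj₂ (trans b≡i (trans (sym (inc3-dec3 i)) (cong inc3 (sym a≡i-1))))
edge-climbs G ℓ d (inj₂ (inj₁ (i , inj₂ (d≡i , a≡i , b≡i+1 , _)))) =
  inj₁ (trans a≡i (sym d≡i)) ,
  inj₂ (trans b≡i+1 (cong inc3 (sym a≡i)))
edge-climbs G ℓ d (inj₂ (inj₂ (i , inj₁ (a≡i , b≡i , _ , d≡i-1)))) =
  inj₂ (trans a≡i (trans (sym (inc3-dec3 i)) (cong inc3 (sym d≡i-1)))) ,
  inj₁ (trans b≡i (sym a≡i))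
edge-climbs G ℓ d (inj₂ (inj₂ (i , inj₂ (_ , d≡i , a≡i+1 , b≡i-1)))) =
  inj₂ (trans a≡i+1 (cong inc3 (sym d≡i))) ,
  inj₂ (trans b≡i-1 (trans (dec3≡inc3² i) (cong inc3 (sym a≡i+1))))

-- angle σ d follows angle d around a vertex; use the edge of σ d
vertex-climbs : (G : Map) (ℓ : Labeling G) → IsEDGE G ℓ → ∀ d → Climbs (ℓ d) (ℓ (σ→ G d))
vertex-climbs G ℓ edge d = subst (λ e → Climbs (ℓ e) (ℓ (σ→ G d))) (inverseˡ (σ G))
  (proj₁ (edge-climbs G ℓ (σ→ G d) (edge (σ→ G d))))

face-climbs : (G : Map) (ℓ : Labeling G) → IsEDGE G ℓ → ∀ d → Climbs (ℓ d) (ℓ (φ→ G d))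
face-climbs G ℓ edge d = proj₂ (edge-climbs G ℓ d (edge d))

lemma3 : (G : Map) (ℓ : Labeling G) → IsEDGE G ℓ → IsVERTEX G ℓ × IsFACE G ℓ
lemma3 G ℓ edge =
    climbing-orbits-have-types ℓ (σ→ G) (vertex-climbs G ℓ edge)
  , climbing-orbits-have-types ℓ (φ→ G) (face-climbs G ℓ edge)
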